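{- Let $\mathcal{E}_n,\mathcal{E}_m,\mathcal{F}_n,\mathcal{F}_m$ be presheaf topoi, $\rho_n:\mathcal{E}_n\to\mathcal{F}_n$, $\rho_m:\mathcal{E}_m\to\mathcal{F}_m$ continuous functors, and $f:\mathcal{E}_n\to\mathcal{E}_m$, $g:\mathcal{F}_n\to\mathcal{F}_m$ right adjoints preserving finite colimits with $g\circ\rho_n=\rho_m\circ f$. Then $\mathbf{Gl}[f,g](\mathbf{Syn}_n)\cong\mathbf{Syn}_m$; that is, in the induced model of extensional $\mathsf{MTT}$ with modality $\mu:n\to m$ interpreted by $\mathbf{Gl}[f,g]$, one has $\langle\mu\mid\mathbf{Syn}_n\rangle\cong\mathbf{Syn}_m$.
   Context: The Artin gluing $\mathbf{Gl}(\rho)$ of $\rho:\mathcal{E}\to\mathcal{F}$ has objects $(E,F,x:F\to\rho(E))$ and morphisms commuting squares. $\mathbf{Gl}[f,g]:\mathbf{Gl}(\rho_n)\to\mathbf{Gl}(\rho_m)$ sends $(E,F,x)$ to $(f(E),g(F),g(x))$; it is a right adjoint and is used to interpret the modal type $\langle\mu\mid-\rangle$ for the mode theory with one modality $\mu:n\to m$. For $k\in\{n,m\}$, $\mathbf{Syn}_k$ is the subterminal object $(1_{\mathcal{E}_k},0_{\mathcal{F}_k},0\to\rho_k(1))$ of $\mathbf{Gl}(\rho_k)$. -}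

module Defs where

open import Level using (Level; _⊔_) renaming (zero to lzero; suc to lsuc)
open import Data.Nat using (ℕ)
open import Data.Fin using (Fin)
open import Data.Unit using (⊤; tt)
open import Data.Empty using (⊥)
open import Data.Product using (Σ; _×_; _,_; proj₁; proj₂)
open import Relation.Binary using (Setoid; IsEquivalence)
open import Relation.Binary.PropositionalEquality as ≡ using (_≡_)
open import Function.Bundles using (Inverse)

record Category (o ℓ e : Level) : Set (lsuc (o ⊔ ℓ ⊔ e)) where
  infix 4 _≈_
  infixr 9 _∘_
  field
    Obj : Set o
    _⇒_ : Obj → Obj → Set ℓ
    _≈_ : ∀ {A B} → A ⇒ B → A ⇒ B → Set e
    id : ∀ {A} → A ⇒ A
    _∘_ : ∀ {A B C} → B ⇒ C → A ⇒ B → A ⇒ C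
    ≈-equiv : ∀ {A B} → IsEquivalence (_≈_ {A} {B})
    assoc : ∀ {A B C D} {f : A ⇒ B} {g : B ⇒ C} {h : C ⇒ D} →
            (h ∘ g) ∘ f ≈ h ∘ (g ∘ f)
    identityˡ : ∀ {A B} {f : A ⇒ B} → id ∘ f ≈ f
    identityʳ : ∀ {A B} {f : A ⇒ B} → f ∘ id ≈ f
    ∘-resp-≈ : ∀ {A B C} {f h : B ⇒ C} {g i : A ⇒ B} →
               f ≈ h → g ≈ i → f ∘ g ≈ h ∘ i

  homSetoid : Obj → Obj → Setoid ℓ e
  homSetoid A B = record { Carrier = A ⇒ B ; _≈_ = _≈_ ; isEquivalence = ≈-equiv }

  ≈-refl : ∀ {A B} {f : A ⇒ B} → f ≈ f
  ≈-refl = IsEquivalence.refl ≈-equiv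
  ≈-sym : ∀ {A B} {f g : A ⇒ B} → f ≈ g → g ≈ f
  ≈-sym = IsEquivalence.sym ≈-equiv
  ≈-trans : ∀ {A B} {f g h : A ⇒ B} → f ≈ g → g ≈ h → f ≈ h
  ≈-trans = IsEquivalence.trans ≈-equiv

record Iso {o ℓ e} (C : Category o ℓ e) (A B : Category.Obj C) : Set (ℓ ⊔ e) where
  open Category C
  field
    from : A ⇒ B
    to   : B ⇒ A
    isoˡ : to ∘ from ≈ id
    isoʳ : from ∘ to ≈ id

record Functor {o ℓ e o′ ℓ′ e′} (C : Category o ℓ e) (D : Category o′ ℓ′ e′)
       : Set (o ⊔ ℓ ⊔ e ⊔ o′ ⊔ ℓ′ ⊔ e′) where
  private
    module C = Category C
    module D = Category D
  field
    F₀ : C.Obj → D.Obj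
    F₁ : ∀ {A B} → A C.⇒ B → F₀ A D.⇒ F₀ B
    identity : ∀ {A} → F₁ (C.id {A}) D.≈ D.id
    homomorphism : ∀ {A B X} {f : A C.⇒ B} {g : B C.⇒ X} →
                   F₁ (g C.∘ f) D.≈ F₁ g D.∘ F₁ f
    F-resp-≈ : ∀ {A B} {f g : A C.⇒ B} → f C.≈ g → F₁ f D.≈ F₁ g

infixr 9 _∘F_
_∘F_ : ∀ {o ℓ e o′ ℓ′ e′ o″ ℓ″ e″}
         {C : Category o ℓ e} {D : Category o′ ℓ′ e′} {E : Category o″ ℓ″ e″} →
       Functor D E → Functor C D → Functor C E
_∘F_ {E = E} G F = record
  { F₀ = λ A → G.F₀ (F.F₀ A)
  ; F₁ = λ f → G.F₁ (F.F₁ f)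
  ; identity = E.≈-trans (G.F-resp-≈ F.identity) G.identity
  ; homomorphism = E.≈-trans (G.F-resp-≈ F.homomorphism) G.homomorphism
  ; F-resp-≈ = λ p → G.F-resp-≈ (F.F-resp-≈ p)
  }
  where
    module G = Functor G
    module F = Functor F
    module E = Category E

record NatIso {o ℓ e o′ ℓ′ e′} {C : Category o ℓ e} {D : Category o′ ℓ′ e′}
       (F G : Functor C D) : Set (o ⊔ ℓ ⊔ e ⊔ o′ ⊔ ℓ′ ⊔ e′) where
  private
    module C = Category C
    module D = Category D
    module F = Functor F
    module G = Functor G
  field
    iso : ∀ X → Iso D (F.F₀ X) (G.F₀ X)
    natural : ∀ {X Y} (f : X C.⇒ Y) →
              Iso.from (iso Y) D.∘ F.F₁ f D.≈ G.F₁ f D.∘ Iso.from (iso X)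

record Adjunction {o ℓ e o′ ℓ′ e′} {C : Category o ℓ e} {D : Category o′ ℓ′ e′}
       (L : Functor C D) (R : Functor D C) : Set (o ⊔ ℓ ⊔ e ⊔ o′ ⊔ ℓ′ ⊔ e′) where
  private
    module C = Category C
    module D = Category D
    module L = Functor L
    module R = Functor R
  field
    unit   : ∀ X → X C.⇒ R.F₀ (L.F₀ X)
    counit : ∀ Y → L.F₀ (R.F₀ Y) D.⇒ Y
    unit-natural : ∀ {X X′} (f : X C.⇒ X′) →
                   unit X′ C.∘ f C.≈ R.F₁ (L.F₁ f) C.∘ unit X
    counit-natural : ∀ {Y Y′} (g : Y D.⇒ Y′) →
                     counit Y′ D.∘ L.F₁ (R.F₁ g) D.≈ g D.∘ counit Y
    zig : ∀ X → counit (L.F₀ X) D.∘ L.F₁ (unit X) D.≈ D.id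
    zag : ∀ Y → R.F₁ (counit Y) C.∘ unit (R.F₀ Y) C.≈ C.id

IsRightAdjoint : ∀ {o ℓ e o′ ℓ′ e′} {C : Category o ℓ e} {D : Category o′ ℓ′ e′} →
                 Functor D C → Set (o ⊔ ℓ ⊔ e ⊔ o′ ⊔ ℓ′ ⊔ e′)
IsRightAdjoint {C = C} {D = D} R = Σ (Functor C D) (λ L → Adjunction L R)

module _ {o ℓ e o′ ℓ′ e′} {J : Category o′ ℓ′ e′} {C : Category o ℓ e} where
  private
    module J = Category J
    module C = Category C

  record Cone (D : Functor J C) : Set (o ⊔ ℓ ⊔ e ⊔ o′ ⊔ ℓ′) where
    open Functor D
    field
      apex : C.Obj
      ψ : ∀ j → apex C.⇒ F₀ j
      commute : ∀ {i j} (f : i J.⇒ j) → F₁ f C.∘ ψ i C.≈ ψ j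

  record Cocone (D : Functor J C) : Set (o ⊔ ℓ ⊔ e ⊔ o′ ⊔ ℓ′) where
    open Functor D
    field
      apex : C.Obj
      ψ : ∀ j → F₀ j C.⇒ apex
      commute : ∀ {i j} (f : i J.⇒ j) → ψ j C.∘ F₁ f C.≈ ψ i

  IsLimit : {D : Functor J C} → Cone D → Set (o ⊔ ℓ ⊔ e ⊔ o′ ⊔ ℓ′)
  IsLimit {D} K = ∀ (K′ : Cone D) →
    Σ (Cone.apex K′ C.⇒ Cone.apex K) λ m →
      (∀ j → Cone.ψ K j C.∘ m C.≈ Cone.ψ K′ j) ×
      (∀ m′ → (∀ j → Cone.ψ K j C.∘ m′ C.≈ Cone.ψ K′ j) → m′ C.≈ m)

  IsColimit : {D : Functor J C} → Cocone D → Set (o ⊔ ℓ ⊔ e ⊔ o′ ⊔ ℓ′)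
  IsColimit {D} K = ∀ (K′ : Cocone D) →
    Σ (Cocone.apex K C.⇒ Cocone.apex K′) λ m →
      (∀ j → m C.∘ Cocone.ψ K j C.≈ Cocone.ψ K′ j) ×
      (∀ m′ → (∀ j → m′ C.∘ Cocone.ψ K j C.≈ Cocone.ψ K′ j) → m′ C.≈ m)

module _ {o ℓ e o′ ℓ′ e′ o″ ℓ″ e″} {J : Category o″ ℓ″ e″}
         {C : Category o ℓ e} {E : Category o′ ℓ′ e′} (F : Functor C E) where
  private
    module C = Category C
    module E = Category E
    module F = Functor F

  mapCone : {D : Functor J C} → Cone D → Cone (F ∘F D)
  mapCone K = record
    { apex = F.F₀ (Cone.apex K)
    ; ψ = λ j → F.F₁ (Cone.ψ K j)
    ; commute = λ f → E.≈-trans (E.≈-sym F.homomorphism) (F.F-resp-≈ (Cone.commute K f))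
    }

  mapCocone : {D : Functor J C} → Cocone D → Cocone (F ∘F D)
  mapCocone K = record
    { apex = F.F₀ (Cocone.apex K)
    ; ψ = λ j → F.F₁ (Cocone.ψ K j)
    ; commute = λ f → E.≈-trans (E.≈-sym F.homomorphism) (F.F-resp-≈ (Cocone.commute K f))
    }

  PreservesLimitsOver : Set _
  PreservesLimitsOver = ∀ (D : Functor J C) (K : Cone D) → IsLimit K → IsLimit (mapCone K)

  PreservesColimitsOver : Set _
  PreservesColimitsOver = ∀ (D : Functor J C) (K : Cocone D) → IsColimit K → IsColimit (mapCocone K)

IsFinite : Category lzero lzero lzero → Set
IsFinite J =
  Σ ℕ (λ n → Inverse (≡.setoid Obj) (≡.setoid (Fin n))) ×
  (∀ a b → Σ ℕ (λ k → Inverse (homSetoid a b) (≡.setoid (Fin k))))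
  where open Category J

Continuous : ∀ {o ℓ e o′ ℓ′ e′} {C : Category o ℓ e} {E : Category o′ ℓ′ e′} →
             Functor C E → Set _
Continuous F = ∀ (J : Category lzero lzero lzero) → PreservesLimitsOver {J = J} F

PreservesFiniteColimits : ∀ {o ℓ e o′ ℓ′ e′} {C : Category o ℓ e} {E : Category o′ ℓ′ e′} →
                          Functor C E → Set _
PreservesFiniteColimits F =
  ∀ (J : Category lzero lzero lzero) → IsFinite J → PreservesColimitsOver {J = J} F

module _ (C : Category lzero lzero lzero) where
  private module C = Category C

  record Presheaf : Set₁ where
    field
      P₀ : C.Obj → Set
      P₁ : ∀ {A B} → A C.⇒ B → P₀ B → P₀ A
      P-resp : ∀ {A B} {f g : A C.⇒ B} → f C.≈ g → ∀ x → P₁ f x ≡ P₁ g x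
      P-id : ∀ {A} x → P₁ (C.id {A}) x ≡ x
      P-∘ : ∀ {A B X} (f : A C.⇒ B) (g : B C.⇒ X) x → P₁ (g C.∘ f) x ≡ P₁ f (P₁ g x)

  record PshHom (P Q : Presheaf) : Set where
    private
      module P = Presheaf P
      module Q = Presheaf Q
    field
      η : ∀ A → P.P₀ A → Q.P₀ A
      natural : ∀ {A B} (f : A C.⇒ B) x → η A (P.P₁ f x) ≡ Q.P₁ f (η B x)

  Psh : Category (lsuc lzero) lzero lzero
  Psh = record
    { Obj = Presheaf
    ; _⇒_ = PshHom
    ; _≈_ = λ α β → ∀ A x → PshHom.η α A x ≡ PshHom.η β A x
    ; id = record { η = λ _ x → x ; natural = λ _ _ → ≡.refl }
    ; _∘_ = λ α β → record
        { η = λ A x → PshHom.η α A (PshHom.η β A x)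
        ; natural = λ {A} {B} f x →
            ≡.trans (≡.cong (PshHom.η α A) (PshHom.natural β f x))
                    (PshHom.natural α f (PshHom.η β B x)) }
    ; ≈-equiv = record
        { refl = λ _ _ → ≡.refl
        ; sym = λ p A x → ≡.sym (p A x)
        ; trans = λ p q A x → ≡.trans (p A x) (q A x) }
    ; assoc = λ _ _ → ≡.refl
    ; identityˡ = λ _ _ → ≡.refl
    ; identityʳ = λ _ _ → ≡.refl
    ; ∘-resp-≈ = λ {_} {_} {_} {f} {h} {g} {i} p q A x →
        ≡.trans (≡.cong (PshHom.η f A) (q A x)) (p A (PshHom.η i A x))
    }

  ⊤Psh : Presheaf
  ⊤Psh = record
    { P₀ = λ _ → ⊤ ; P₁ = λ _ _ → tt
    ; P-resp = λ _ _ → ≡.refl ; P-id = λ _ → ≡.refl ; P-∘ = λ _ _ _ → ≡.refl }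

  ⊥Psh : Presheaf
  ⊥Psh = record
    { P₀ = λ _ → ⊥ ; P₁ = λ _ ()
    ; P-resp = λ _ () ; P-id = λ () ; P-∘ = λ _ _ () }

  ¡Psh : (P : Presheaf) → PshHom ⊥Psh P
  ¡Psh P = record { η = λ _ () ; natural = λ _ () }

module _ {o ℓ e o′ ℓ′ e′} {E : Category o ℓ e} {F : Category o′ ℓ′ e′}
         (ρ : Functor E F) where
  private
    module E = Category E
    module F = Category F
    module ρ = Functor ρ

  record GlObj : Set (o ⊔ o′ ⊔ ℓ′) where
    constructor glObj
    field
      objE : E.Obj
      objF : F.Obj
      arr  : objF F.⇒ ρ.F₀ objE

  record GlHom (X Y : GlObj) : Set (ℓ ⊔ ℓ′ ⊔ e′) where
    private
      module X = GlObj X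
      module Y = GlObj Y
    field
      homE : X.objE E.⇒ Y.objE
      homF : X.objF F.⇒ Y.objF
      comm : ρ.F₁ homE F.∘ X.arr F.≈ Y.arr F.∘ homF

  Gl : Category (o ⊔ o′ ⊔ ℓ′) (ℓ ⊔ ℓ′ ⊔ e′) (e ⊔ e′)
  Gl = record
    { Obj = GlObj
    ; _⇒_ = GlHom
    ; _≈_ = λ u v → (GlHom.homE u E.≈ GlHom.homE v) × (GlHom.homF u F.≈ GlHom.homF v)
    ; id = λ {X} → record
        { homE = E.id ; homF = F.id
        ; comm = F.≈-trans (F.∘-resp-≈ ρ.identity F.≈-refl)
                  (F.≈-trans F.identityˡ (F.≈-sym F.identityʳ)) }
    ; _∘_ = λ {X} {Y} {Z} v u → record
        { homE = GlHom.homE v E.∘ GlHom.homE u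
        ; homF = GlHom.homF v F.∘ GlHom.homF u
        ; comm =
            F.≈-trans (F.∘-resp-≈ ρ.homomorphism F.≈-refl)
           (F.≈-trans F.assoc
           (F.≈-trans (F.∘-resp-≈ F.≈-refl (GlHom.comm u))
           (F.≈-trans (F.≈-sym F.assoc)
           (F.≈-trans (F.∘-resp-≈ (GlHom.comm v) F.≈-refl)
                       F.assoc)))) }
    ; ≈-equiv = record
        { refl = E.≈-refl , F.≈-refl
        ; sym = λ p → E.≈-sym (proj₁ p) , F.≈-sym (proj₂ p)
        ; trans = λ p q → E.≈-trans (proj₁ p) (proj₁ q) , F.≈-trans (proj₂ p) (proj₂ q) }
    ; assoc = E.assoc , F.assoc
    ; identityˡ = E.identityˡ , F.identityˡ
    ; identityʳ = E.identityʳ , F.identityʳ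
    ; ∘-resp-≈ = λ p q → E.∘-resp-≈ (proj₁ p) (proj₁ q) , F.∘-resp-≈ (proj₂ p) (proj₂ q)
    }

-- Object part of Gl[f,g] : Gl(ρn) → Gl(ρm), (E,F,x) ↦ (f E, g F, g x),
-- where g x : g F → g (ρn E) is composed with the identification
-- g (ρn E) ≅ ρm (f E) witnessing g ∘ ρn = ρm ∘ f.
Gl[_,_]₀ : ∀ {o ℓ e o′ ℓ′ e′ o″ ℓ″ e″ o‴ ℓ‴ e‴}
           {En : Category o ℓ e} {Fn : Category o′ ℓ′ e′}
           {Em : Category o″ ℓ″ e″} {Fm : Category o‴ ℓ‴ e‴}
           {ρn : Functor En Fn} {ρm : Functor Em Fm}
           (f : Functor En Em) (g : Functor Fn Fm) →
           NatIso (g ∘F ρn) (ρm ∘F f) → GlObj ρn → GlObj ρm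
Gl[_,_]₀ {Fm = Fm} f g φ (glObj E F x) =
  glObj (Functor.F₀ f E) (Functor.F₀ g F)
        (Category._∘_ Fm (Iso.from (NatIso.iso φ E)) (Functor.F₁ g x))

Syn : {C D : Category lzero lzero lzero} (ρ : Functor (Psh C) (Psh D)) → GlObj ρ
Syn {C} {D} ρ = glObj (⊤Psh C) (⊥Psh D) (¡Psh D (Functor.F₀ ρ (⊤Psh C)))

module Submission where

open import Defs
open import Level using (_⊔_) renaming (zero to lzero)
open import Data.Empty using (⊥)
open import Data.Unit using (tt)
open import Data.Fin.Properties using (0↔⊥)
open import Data.Product using (Σ; _,_; proj₁; proj₂)
open import Function.Properties.Inverse using (↔-sym)
import Relation.Binary.PropositionalEquality as ≡
import Relation.Binary.Reasoning.Setoid as SetoidReasoning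

-- A right adjoint preserves the
-- terminal object, so f 1 ≅ 1; a functor preserving finite colimits preserves
-- the initial object (the colimit of the empty diagram), so g 0 ≅ 0. Both glued
-- arrows start at an initial object, so the square for these component
-- isomorphisms commutes automatically.

module _ {o ℓ e} (C : Category o ℓ e) where
  open Category C

  IsInitial : Obj → Set (o ⊔ ℓ ⊔ e)
  IsInitial I = ∀ X → Σ (I ⇒ X) λ h → ∀ h′ → h′ ≈ h

  IsTerminal : Obj → Set (o ⊔ ℓ ⊔ e)
  IsTerminal T = ∀ X → Σ (X ⇒ T) λ h → ∀ h′ → h′ ≈ h

  initial-arrows-equal : ∀ {I X} → IsInitial I → {h h′ : I ⇒ X} → h ≈ h′
  initial-arrows-equal {X = X} i = ≈-trans (proj₂ (i X) _) (≈-sym (proj₂ (i X) _))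

  terminal-arrows-equal : ∀ {T X} → IsTerminal T → {h h′ : X ⇒ T} → h ≈ h′
  terminal-arrows-equal {X = X} t = ≈-trans (proj₂ (t X) _) (≈-sym (proj₂ (t X) _))

  initial-unique : ∀ {I J} → IsInitial I → IsInitial J → Iso C I J
  initial-unique {I} {J} i j = record
    { from = proj₁ (i J)
    ; to   = proj₁ (j I)
    ; isoˡ = initial-arrows-equal i
    ; isoʳ = initial-arrows-equal j
    }

  terminal-unique : ∀ {S T} → IsTerminal S → IsTerminal T → Iso C S T
  terminal-unique {S} {T} s t = record
    { from = proj₁ (t S)
    ; to   = proj₁ (s T)
    ; isoˡ = terminal-arrows-equal s
    ; isoʳ = terminal-arrows-equal t
    }

module _ (C : Category lzero lzero lzero) where

  ⊥Psh-isInitial : IsInitial (Psh C) (⊥Psh C)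
  ⊥Psh-isInitial P = ¡Psh C P , λ _ _ ()

  ⊤Psh-isTerminal : IsTerminal (Psh C) (⊤Psh C)
  ⊤Psh-isTerminal P = record { η = λ _ _ → tt ; natural = λ _ _ → ≡.refl } , λ _ _ _ → ≡.refl

module _ {o ℓ e o′ ℓ′ e′} {C : Category o ℓ e} {D : Category o′ ℓ′ e′}
         {L : Functor C D} {R : Functor D C} (adj : Adjunction L R) where
  private
    module C = Category C
    module D = Category D
    module L = Functor L
    module R = Functor R
    open Adjunction adj

  transpose-transpose : ∀ {X T} (u : X C.⇒ R.F₀ T) →
                        u C.≈ R.F₁ (counit T D.∘ L.F₁ u) C.∘ unit X
  transpose-transpose {X} {T} u = begin
    u                                           ≈⟨ C.≈-sym C.identityˡ ⟩
    C.id C.∘ u                                  ≈⟨ C.∘-resp-≈ (C.≈-sym (zag T)) C.≈-refl ⟩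
    (R.F₁ (counit T) C.∘ unit (R.F₀ T)) C.∘ u   ≈⟨ C.assoc ⟩
    R.F₁ (counit T) C.∘ (unit (R.F₀ T) C.∘ u)   ≈⟨ C.∘-resp-≈ C.≈-refl (unit-natural u) ⟩
    R.F₁ (counit T) C.∘ (R.F₁ (L.F₁ u) C.∘ unit X) ≈⟨ C.≈-sym C.assoc ⟩
    (R.F₁ (counit T) C.∘ R.F₁ (L.F₁ u)) C.∘ unit X ≈⟨ C.∘-resp-≈ (C.≈-sym R.homomorphism) C.≈-refl ⟩
    R.F₁ (counit T D.∘ L.F₁ u) C.∘ unit X       ∎
    where open SetoidReasoning (C.homSetoid X (R.F₀ T))

  rightAdjoint-preserves-terminal : ∀ {T} → IsTerminal D T → IsTerminal C (R.F₀ T)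
  rightAdjoint-preserves-terminal {T} t X =
    R.F₁ (proj₁ (t (L.F₀ X))) C.∘ unit X ,
    λ u → C.≈-trans (transpose-transpose u)
                    (C.∘-resp-≈ (R.F-resp-≈ (proj₂ (t (L.F₀ X)) _)) C.≈-refl)

⊥Cat : Category lzero lzero lzero
⊥Cat = record
  { Obj = ⊥ ; _⇒_ = λ () ; _≈_ = λ { {()} } ; id = λ { {()} } ; _∘_ = λ { {()} }
  ; ≈-equiv = λ { {()} } ; assoc = λ { {()} } ; identityˡ = λ { {()} }
  ; identityʳ = λ { {()} } ; ∘-resp-≈ = λ { {()} } }

⊥Cat-isFinite : IsFinite ⊥Cat
⊥Cat-isFinite = (0 , ↔-sym 0↔⊥) , λ ()

module _ {o ℓ e} {C : Category o ℓ e} where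
  private module C = Category C

  emptyDiagram : Functor ⊥Cat C
  emptyDiagram = record
    { F₀ = λ () ; F₁ = λ { {()} } ; identity = λ { {()} }
    ; homomorphism = λ { {()} } ; F-resp-≈ = λ { {()} } }

  emptyCocone : (Δ : Functor ⊥Cat C) → C.Obj → Cocone Δ
  emptyCocone Δ X = record { apex = X ; ψ = λ () ; commute = λ { {()} } }

  initial⇒emptyColimit : ∀ {Δ I} → IsInitial C I → IsColimit (emptyCocone Δ I)
  initial⇒emptyColimit i K = proj₁ (i (Cocone.apex K)) , (λ ()) , λ m _ → proj₂ (i (Cocone.apex K)) m

module _ {o ℓ e o′ ℓ′ e′} {C : Category o ℓ e} {D : Category o′ ℓ′ e′}
         (F : Functor C D) (F-finCocont : PreservesFiniteColimits F) where
  private module F = Functor F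

  finitelyCocontinuous-preserves-initial : ∀ {I} → IsInitial C I → IsInitial D (F.F₀ I)
  finitelyCocontinuous-preserves-initial {I} i X =
    proj₁ colim , λ m → proj₂ (proj₂ colim) m (λ ())
    where
      colim = F-finCocont ⊥Cat ⊥Cat-isFinite emptyDiagram (emptyCocone emptyDiagram I)
                (initial⇒emptyColimit i) (emptyCocone (F ∘F emptyDiagram) X)

module _ {o ℓ e o′ ℓ′ e′} {E : Category o ℓ e} {F : Category o′ ℓ′ e′}
         (ρ : Functor E F) where
  private
    module E = Category E
    module F = Category F
    module ρ = Functor ρ
  open GlObj

  Gl-iso : ∀ {X Y} (i : Iso E (objE X) (objE Y)) (j : Iso F (objF X) (objF Y)) →
           ρ.F₁ (Iso.from i) F.∘ arr X F.≈ arr Y F.∘ Iso.from j →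
           Iso (Gl ρ) X Y
  Gl-iso {X} {Y} i j from-comm = record
    { from = record { homE = i.from ; homF = j.from ; comm = from-comm }
    ; to   = record { homE = i.to ; homF = j.to ; comm = to-comm }
    ; isoˡ = i.isoˡ , j.isoˡ
    ; isoʳ = i.isoʳ , j.isoʳ
    }
    where
      module i = Iso i
      module j = Iso j
      open SetoidReasoning (F.homSetoid (objF Y) (ρ.F₀ (objE X)))
      to-comm : ρ.F₁ i.to F.∘ arr Y F.≈ arr X F.∘ j.to
      to-comm = begin
        ρ.F₁ i.to F.∘ arr Y                                 ≈⟨ F.∘-resp-≈ F.≈-refl (F.≈-sym F.identityʳ) ⟩
        ρ.F₁ i.to F.∘ (arr Y F.∘ F.id)                      ≈⟨ F.∘-resp-≈ F.≈-refl (F.∘-resp-≈ F.≈-refl (F.≈-sym j.isoʳ)) ⟩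
        ρ.F₁ i.to F.∘ (arr Y F.∘ (j.from F.∘ j.to))         ≈⟨ F.∘-resp-≈ F.≈-refl (F.≈-sym F.assoc) ⟩
        ρ.F₁ i.to F.∘ ((arr Y F.∘ j.from) F.∘ j.to)         ≈⟨ F.∘-resp-≈ F.≈-refl (F.∘-resp-≈ (F.≈-sym from-comm) F.≈-refl) ⟩
        ρ.F₁ i.to F.∘ ((ρ.F₁ i.from F.∘ arr X) F.∘ j.to)    ≈⟨ F.∘-resp-≈ F.≈-refl F.assoc ⟩
        ρ.F₁ i.to F.∘ (ρ.F₁ i.from F.∘ (arr X F.∘ j.to))    ≈⟨ F.≈-sym F.assoc ⟩
        (ρ.F₁ i.to F.∘ ρ.F₁ i.from) F.∘ (arr X F.∘ j.to)    ≈⟨ F.∘-resp-≈ (F.≈-sym ρ.homomorphism) F.≈-refl ⟩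
        ρ.F₁ (i.to E.∘ i.from) F.∘ (arr X F.∘ j.to)         ≈⟨ F.∘-resp-≈ (F.≈-trans (ρ.F-resp-≈ i.isoˡ) ρ.identity) F.≈-refl ⟩
        F.id F.∘ (arr X F.∘ j.to)                           ≈⟨ F.identityˡ ⟩
        arr X F.∘ j.to                                      ∎

  Gl-iso-initialF : ∀ {X Y} → IsInitial F (objF X) →
                    Iso E (objE X) (objE Y) → Iso F (objF X) (objF Y) → Iso (Gl ρ) X Y
  Gl-iso-initialF X-initial i j = Gl-iso i j (initial-arrows-equal F X-initial)

lemma4p12 : (Cn Cm Dn Dm : Category lzero lzero lzero)
            (ρn : Functor (Psh Cn) (Psh Dn)) (ρm : Functor (Psh Cm) (Psh Dm)) →
            Continuous ρn → Continuous ρm →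
            (f : Functor (Psh Cn) (Psh Cm)) (g : Functor (Psh Dn) (Psh Dm)) →
            IsRightAdjoint f → IsRightAdjoint g →
            PreservesFiniteColimits f → PreservesFiniteColimits g →
            (φ : NatIso (g ∘F ρn) (ρm ∘F f)) →
            Iso (Gl ρm) (Gl[ f , g ]₀ φ (Syn ρn)) (Syn ρm)
lemma4p12 Cn Cm Dn Dm ρn ρm _ _ f g (_ , f-adj) _ _ g-finCocont φ =
  Gl-iso-initialF ρm g⊥-initial f⊤≅⊤ g⊥≅⊥
  where
    f⊤-terminal : IsTerminal (Psh Cm) (Functor.F₀ f (⊤Psh Cn))
    f⊤-terminal = rightAdjoint-preserves-terminal f-adj (⊤Psh-isTerminal Cn)

    g⊥-initial : IsInitial (Psh Dm) (Functor.F₀ g (⊥Psh Dn))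
    g⊥-initial = finitelyCocontinuous-preserves-initial g g-finCocont (⊥Psh-isInitial Dn)

    f⊤≅⊤ : Iso (Psh Cm) (Functor.F₀ f (⊤Psh Cn)) (⊤Psh Cm)
    f⊤≅⊤ = terminal-unique (Psh Cm) f⊤-terminal (⊤Psh-isTerminal Cm)

    g⊥≅⊥ : Iso (Psh Dm) (Functor.F₀ g (⊥Psh Dn)) (⊥Psh Dm)
    g⊥≅⊥ = initial-unique (Psh Dm) g⊥-initial (⊥Psh-isInitial Dm)
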